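{- Let $\Sigma=[(s_0),\ \{(k)\leadsto (e_1(k))\,(e_2(k))\cdots(e_k(k))\}]$ be an ECO-system with generating function $F(z)=\sum_{n\ge0}f_nz^n$, and let $\sigma(k)=e_1(k)+e_2(k)+\cdots+e_k(k)$. If $\sigma$ is an affine function of $k$, say $\sigma(k)=\alpha k+\beta$ for constants $\alpha,\beta$, then $F(z)$ is rational; more precisely $$F(z)=\frac{1+(s_0-\alpha)z}{1-\alpha z-\beta z^2}.$$
   Context: An ECO-system $[(s_0),\ \{(k)\leadsto (e_1(k))\cdots(e_k(k))\}]$ consists of a positive integer axiom $s_0$ and, for each positive integer label $k$, a list of $k$ positive integers $e_1(k),\dots,e_k(k)$. Its generating tree is the rooted plane tree whose root is labeled $s_0$ and in which every node labeled $k$ has exactly $k$ children, labeled $e_1(k),\dots,e_k(k)$. The root is at level $0$; $f_n$ denotes the number of nodes at level $n$ (so $f_0=1$), and $F(z)=\sum_{n\ge0} f_n z^n$. -}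

module Defs where

open import Data.Nat using (ℕ; zero; suc; _≤_)
import Data.Nat as ℕ
open import Data.Integer using (ℤ; +_; _+_; _*_; _-_; -_)
open import Data.Vec using (Vec; []; _∷_; map)
import Data.Vec as Vec
open import Data.Vec.Relation.Unary.All using (All)
open import Data.Product using (_×_)
open import Relation.Binary.PropositionalEquality using (_≡_)

-- An ECO-system: a positive axiom s₀ and, for every label k, a list of k labels
-- e₁(k),…,eₖ(k).  (For k = 0 the list is empty and is never used, since all
-- labels are positive.)
record ECO : Set where
  field
    axiom : ℕ
    rule  : (k : ℕ) → Vec ℕ k

IsECO : ECO → Set
IsECO Σ = (1 ≤ ECO.axiom Σ) × (∀ k → 1 ≤ k → All (1 ≤_) (ECO.rule Σ k))

-- levelCount Σ n ℓ = number of nodes at level n of the generating tree whose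
-- root is labelled ℓ (a node labelled k has exactly the children e₁(k)…eₖ(k)).
levelCount : ECO → ℕ → ℕ → ℕ
levelCount Σ zero    ℓ = 1
levelCount Σ (suc n) ℓ = Vec.sum (map (levelCount Σ n) (ECO.rule Σ ℓ))

f : ECO → ℕ → ℕ
f Σ n = levelCount Σ n (ECO.axiom Σ)

σ : ECO → ℕ → ℕ
σ Σ k = Vec.sum (ECO.rule Σ k)

FPS : Set
FPS = ℕ → ℤ

genFun : ECO → FPS
genFun Σ n = + f Σ n

poly : ∀ {m} → Vec ℤ m → FPS
poly []       n       = + 0
poly (a ∷ as) zero    = a
poly (a ∷ as) (suc n) = poly as n

conv : FPS → FPS → ℕ → ℤ
conv a b zero    = a 0 * b 0
conv a b (suc n) = a 0 * b (suc n) + conv (λ i → a (suc i)) b n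

_·_ : FPS → FPS → FPS
(a · b) n = conv a b n

_≐_ : FPS → FPS → Set
a ≐ b = ∀ n → a n ≡ b n

-- In ℤ[[z]], since 1 - αz - βz² has constant term 1 it is invertible, so
--   F = (1 + (s₀ - α) z) / (1 - α z - β z²)
-- means exactly  (1 - α z - β z²) · F = 1 + (s₀ - α) z.
_≐_/_ : FPS → FPS → FPS → Set
F ≐ N / D = (D · F) ≐ N

-- Summing over the children of a node, the level counts of its subtree satisfy
-- L(n+2, ℓ) = Σ_c L(n+1, c)  for the children c of ℓ.  If every label obeys the
-- linear recurrence L(n+2) = α L(n+1) + β L(n), so does this sum; the base case
-- n = 0 is exactly the hypothesis σ(ℓ) = α ℓ + β, because L(1, ℓ) = ℓ.  Hence
-- f_{n+2} = α f_{n+1} + β f_n with f_0 = 1 and f_1 = s₀, which is the stated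
-- identity (1 - αz - βz²) F(z) = 1 + (s₀ - α) z read coefficientwise.
module Submission where

open import Defs
open import Data.Nat using (ℕ; _≤_; zero; suc)
import Data.Nat as ℕ
open import Data.Integer using (ℤ; +_; _+_; _*_; _-_; -_)
open import Data.Integer.Properties using (pos-+)
open import Data.Integer.Tactic.RingSolver using (solve-∀)
open import Data.Vec using (Vec; _∷_; []; map)
import Data.Vec as Vec
open import Data.Vec.Properties using (map-cong; map-id)
open import Data.Vec.Relation.Unary.All using (All; []; _∷_)
open import Data.Product using (proj₁; proj₂)
open import Relation.Binary.PropositionalEquality
open ≡-Reasoning

sum-map-linear : ∀ {A : Set} {P : A → Set} (α β : ℤ) (g f h : A → ℕ)
  → (∀ {x} → P x → + g x ≡ α * + f x + β * + h x)
  → ∀ {k} {v : Vec A k} → All P v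
  → + Vec.sum (map g v) ≡ α * + Vec.sum (map f v) + β * + Vec.sum (map h v)
sum-map-linear α β g f h pointwise [] = zero-linear α β
  where
  zero-linear : ∀ (a b : ℤ) → + 0 ≡ a * + 0 + b * + 0
  zero-linear = solve-∀
sum-map-linear α β g f h pointwise {v = x ∷ v} (px ∷ pv) = begin
  + (g x ℕ.+ Vec.sum (map g v))
    ≡⟨ pos-+ (g x) _ ⟩
  + g x + + Vec.sum (map g v)
    ≡⟨ cong₂ _+_ (pointwise px) (sum-map-linear α β g f h pointwise pv) ⟩
  (α * + f x + β * + h x) + (α * + Vec.sum (map f v) + β * + Vec.sum (map h v))
    ≡⟨ regroup α β _ _ _ _ ⟩
  α * (+ f x + + Vec.sum (map f v)) + β * (+ h x + + Vec.sum (map h v))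
    ≡⟨ sym (cong₂ (λ y z → α * y + β * z) (pos-+ (f x) _) (pos-+ (h x) _)) ⟩
  α * + (f x ℕ.+ Vec.sum (map f v)) + β * + (h x ℕ.+ Vec.sum (map h v))
    ∎
  where
  regroup : ∀ (a b x y p q : ℤ)
    → (a * x + b * p) + (a * y + b * q) ≡ a * (x + y) + b * (p + q)
  regroup = solve-∀

sum-map-const-one : ∀ {A : Set} {k} (v : Vec A k) → Vec.sum (map (λ _ → 1) v) ≡ k
sum-map-const-one []      = refl
sum-map-const-one (_ ∷ v) = cong suc (sum-map-const-one v)

levelCount-one : (Σ : ECO) (ℓ : ℕ) → levelCount Σ 1 ℓ ≡ ℓ
levelCount-one Σ ℓ = sum-map-const-one (ECO.rule Σ ℓ)

levelCount-one-sum : (Σ : ECO) (ℓ : ℕ) → Vec.sum (map (levelCount Σ 1) (ECO.rule Σ ℓ)) ≡ σ Σ ℓ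
levelCount-one-sum Σ ℓ =
  cong Vec.sum (trans (map-cong (levelCount-one Σ) (ECO.rule Σ ℓ)) (map-id (ECO.rule Σ ℓ)))

levelCount-recurrence : (Σ : ECO) → IsECO Σ → (α β : ℤ)
  → (∀ k → 1 ≤ k → + σ Σ k ≡ α * + k + β)
  → ∀ n ℓ → 1 ≤ ℓ
  → + levelCount Σ (suc (suc n)) ℓ ≡ α * + levelCount Σ (suc n) ℓ + β * + levelCount Σ n ℓ
levelCount-recurrence Σ wf α β σ-affine zero ℓ 1≤ℓ = begin
  + Vec.sum (map (levelCount Σ 1) (ECO.rule Σ ℓ)) ≡⟨ cong +_ (levelCount-one-sum Σ ℓ) ⟩
  + σ Σ ℓ                                        ≡⟨ σ-affine ℓ 1≤ℓ ⟩
  α * + ℓ + β                                    ≡⟨ cong₂ (λ x y → α * + x + y) (sym (levelCount-one Σ ℓ)) (times-one β) ⟩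
  α * + levelCount Σ 1 ℓ + β * + 1               ∎
  where
  times-one : ∀ (b : ℤ) → b ≡ b * + 1
  times-one = solve-∀
levelCount-recurrence Σ wf α β σ-affine (suc n) ℓ 1≤ℓ =
  sum-map-linear α β (levelCount Σ (suc (suc n))) (levelCount Σ (suc n)) (levelCount Σ n)
    (λ {c} 1≤c → levelCount-recurrence Σ wf α β σ-affine n c 1≤c)
    (proj₂ wf ℓ 1≤ℓ)

conv-constant : ∀ (c : ℤ) (b : FPS) n → conv (poly (c ∷ [])) b n ≡ c * b n
conv-constant c b zero    = refl
conv-constant c b (suc n) = trans (cong (_+_ (c * b (suc n))) (conv-zero n)) (plus-zero (c * b (suc n)))
  where
  conv-zero : ∀ m → conv (λ _ → + 0) b m ≡ + 0
  conv-zero zero    = refl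
  conv-zero (suc m) = cong (_+_ (+ 0 * b (suc m))) (conv-zero m)
  plus-zero : ∀ (x : ℤ) → x + + 0 ≡ x
  plus-zero = solve-∀

conv-quadratic : ∀ (a b c : ℤ) (F : FPS) n
  → conv (poly (a ∷ b ∷ c ∷ [])) F (suc (suc n)) ≡ a * F (suc (suc n)) + (b * F (suc n) + c * F n)
conv-quadratic a b c F n = cong (λ x → a * F (suc (suc n)) + (b * F (suc n) + x)) (conv-constant c F n)

proposition2 : (Σ : ECO) → IsECO Σ → (α β : ℤ)
    → (∀ k → 1 ≤ k → + σ Σ k ≡ α * + k + β)
    → genFun Σ ≐ poly (+ 1 ∷ (+ ECO.axiom Σ - α) ∷ [])
    / poly (+ 1 ∷ (- α) ∷ (- β) ∷ [])
proposition2 Σ wf α β σ-affine zero = refl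
proposition2 Σ wf α β σ-affine (suc zero) =
  trans (cong (λ x → + 1 * + x + - α * + 1) (levelCount-one Σ s₀)) (first-coefficient (+ s₀) α)
  where
  s₀ = ECO.axiom Σ
  first-coefficient : ∀ (s a : ℤ) → + 1 * s + - a * + 1 ≡ s - a
  first-coefficient = solve-∀
proposition2 Σ wf α β σ-affine (suc (suc n)) = begin
  conv (poly (+ 1 ∷ - α ∷ - β ∷ [])) F (suc (suc n))
    ≡⟨ conv-quadratic (+ 1) (- α) (- β) F n ⟩
  + 1 * F (suc (suc n)) + (- α * F (suc n) + - β * F n)
    ≡⟨ cong (λ x → + 1 * x + (- α * F (suc n) + - β * F n))
            (levelCount-recurrence Σ wf α β σ-affine n (ECO.axiom Σ) (proj₁ wf)) ⟩
  + 1 * (α * F (suc n) + β * F n) + (- α * F (suc n) + - β * F n)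
    ≡⟨ recurrence-cancels (F (suc n)) (F n) α β ⟩
  + 0 ∎
  where
  F = genFun Σ
  recurrence-cancels : ∀ (y z a b : ℤ) → + 1 * (a * y + b * z) + (- a * y + - b * z) ≡ + 0
  recurrence-cancels = solve-∀
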